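{- Let $G_1$ and $G_2$ be trees, each on the node set $\{1,\dots,n\}$ with $n\ge 2$. Then $G_1$ and $G_2$ are isomorphic if and only if they are $\mathfrak{s}^1$-equivalent.
   Context: For a graph $G=(V,E)$, $N_G(i)$ denotes the set of neighbours of $i$; $\{\dots\}^\#$ denotes a multiset. Fix an integer $k\ge1$ and pairwise distinct nodes $i_1,\dots,i_k$. Define labels $L_l(i)$ for $i\in V$, $l\in\{0,1,2,\dots\}$ recursively: $L_0(i)=(\emptyset,\{c(i)\})$ where $c(i)=q$ if $i=i_q$ and $c(i)=0$ if $i\notin\{i_1,\dots,i_k\}$; for $l\ge1$, $L_l(i)=(L_{l-1}(i),\{L_{l-1}(i'):i'\in N_G(i)\}^\#)$. Labels are formal nested objects compared by structural equality (also across different graphs). Let $M^k_G(i_1,\dots,i_k)$ be the matrix with rows indexed by $V$ and columns by $l\ge0$ with $(i,l)$ entry $L_l(i)$. The object $\mathfrak{s}^k_G(i_1,\dots,i_k)$ is this matrix up to permutation of rows, i.e. the multiset of its rows; thus $\mathfrak{s}^k_{G_1}(i_1,\dots,i_k)=\mathfrak{s}^k_{G_2}(j_1,\dots,j_k)$ means there is a bijection $\pi:V_1\to V_2$ such that row $i$ of $M^k_{G_1}(i_1,\dots,i_k)$ equals row $\pi(i)$ of $M^k_{G_2}(j_1,\dots,j_k)$ for all $i$. For $q=k-1,\dots,0$ and distinct $i_1,\dots,i_q$, let $\mathfrak{s}^k_G(i_1,\dots,i_q)=\{\mathfrak{s}^k_G(i_1,\dots,i_q,i): i\in V\setminus\{i_1,\dots,i_q\}\}^\#$;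 the case $q=0$ gives the fingerprint $\mathfrak{s}^k_G$. Graphs $G_1,G_2$ are $\mathfrak{s}^k$-equivalent if $\mathfrak{s}^k_{G_1}=\mathfrak{s}^k_{G_2}$. Here $k=1$. -}

module Defs where

open import Data.Nat using (ℕ; zero; suc)
open import Data.Bool using (Bool; T; true; false; if_then_else_)
open import Data.Fin using (Fin; zero; suc; inject₁; fromℕ; _≟_)
open import Data.Product using (Σ; Σ-syntax; _×_; _,_; proj₁)
open import Data.Empty using (⊥)
open import Relation.Nullary using (¬_; does)
open import Relation.Binary.PropositionalEquality using (_≡_)
open import Relation.Binary.Construct.Closure.ReflexiveTransitive using (Star)
open import Function.Bundles using (_↔_; Inverse)
open import Function.Definitions using (Injective)

record Graph (n : ℕ) : Set where
  field
    adj     : Fin n → Fin n → Bool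
    sym     : ∀ i j → adj i j ≡ adj j i
    irrefl  : ∀ i → adj i i ≡ false
open Graph public

Adj : ∀ {n} → Graph n → Fin n → Fin n → Set
Adj G i j = T (adj G i j)

Connected : ∀ {n} → Graph n → Set
Connected G = ∀ u v → Star (Adj G) u v

-- A cycle of length m+3 ≥ 3: pairwise distinct nodes v₀,…,v_{m+2}
-- with consecutive nodes adjacent and v_{m+2} adjacent to v₀.
record Cycle {n : ℕ} (G : Graph n) : Set where
  field
    m      : ℕ
    v      : Fin (suc (suc (suc m))) → Fin n
    inj    : Injective _≡_ _≡_ v
    step   : ∀ (k : Fin (suc (suc m))) → Adj G (v (inject₁ k)) (v (suc k))
    close  : Adj G (v (fromℕ (suc (suc m)))) (v zero)

Acyclic : ∀ {n} → Graph n → Set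
Acyclic G = ¬ Cycle G

IsTree : ∀ {n} → Graph n → Set
IsTree G = Connected G × Acyclic G

Isomorphic : ∀ {n} → Graph n → Graph n → Set
Isomorphic {n} G₁ G₂ =
  Σ[ φ ∈ (Fin n ↔ Fin n) ] (∀ i j → adj G₁ i j ≡ adj G₂ (Inverse.to φ i) (Inverse.to φ j))

-- Colour c(i) for k = 1 with marked node a: c(i) = 1 if i = a, else 0.
col : ∀ {n} → Fin n → Fin n → ℕ
col a i = if does (i ≟ a) then 1 else 0

Nbr : ∀ {n} → Graph n → Fin n → Set
Nbr {n} G i = Σ[ i' ∈ Fin n ] Adj G i i'

-- Structural equality of labels L_l(i) (in G₁ with marked node a)
-- and L_l(j) (in G₂ with marked node b), unfolded by recursion on l:
--   L_0(i) = L_0(j)        iff  c(i) = c(j);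
--   L_{l+1}(i) = L_{l+1}(j) iff L_l(i) = L_l(j) and the multisets
--   {L_l(i') : i' ∈ N(i)}# and {L_l(j') : j' ∈ N(j)}# are equal, i.e. there
--   is a bijection N(i) ↔ N(j) preserving L_l.
LabelEq : ∀ {n m} (G₁ : Graph n) (a : Fin n) (G₂ : Graph m) (b : Fin m) →
          ℕ → Fin n → Fin m → Set
LabelEq G₁ a G₂ b zero i j = col a i ≡ col b j
LabelEq G₁ a G₂ b (suc l) i j =
  LabelEq G₁ a G₂ b l i j ×
  Σ[ f ∈ (Nbr G₁ i ↔ Nbr G₂ j) ]
    (∀ x → LabelEq G₁ a G₂ b l (proj₁ x) (proj₁ (Inverse.to f x)))

-- 𝔰¹_{G₁}(a) = 𝔰¹_{G₂}(b): the matrices M¹ agree up to a row permutation π.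
SEq₁ : ∀ {n} (G₁ : Graph n) (a : Fin n) (G₂ : Graph n) (b : Fin n) → Set
SEq₁ {n} G₁ a G₂ b =
  Σ[ π ∈ (Fin n ↔ Fin n) ] (∀ i l → LabelEq G₁ a G₂ b l i (Inverse.to π i))

-- 𝔰¹-equivalence: the multisets {𝔰¹_{G₁}(a) : a ∈ V}# and
-- {𝔰¹_{G₂}(b) : b ∈ V}# are equal, i.e. matched by a bijection σ.
S1Equivalent : ∀ {n} → Graph n → Graph n → Set
S1Equivalent {n} G₁ G₂ =
  Σ[ σ ∈ (Fin n ↔ Fin n) ] (∀ a → SEq₁ G₁ a G₂ (Inverse.to σ a))

{-# OPTIONS --safe #-}
module Submission where

-- An isomorphism transports every label, so it witnesses 𝔰¹-equivalence, using
-- itself as the permutation of the marked nodes and of the rows. Conversely, mark a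
-- node a of G₁ and let c be the node of G₂ whose row matches that of a. Labels of depth
-- at least k know whether a node lies within distance k of the marked node, so an
-- isomorphism between the balls of radius k around a and c can be grown one layer at a
-- time: a node at distance k+1 is sent through the neighbour bijection recorded in the
-- label of its parent. Acyclicity makes this parent unique and forbids edges inside a
-- layer, which is what keeps the extension injective and edge-preserving. As G₁ is
-- connected, some ball is everything, and an injective self-map of Fin n is a bijection.

open import Defs
open import Data.Nat using (ℕ; _≤_)
open import Function.Bundles using (_⇔_)

open import Data.Nat using (zero; suc; s≤s; _⊔_; _≤′_; ≤′-refl; ≤′-step)
open import Data.Nat.Properties using (≤-refl; ≤-trans; n≤1+n; m<n⇒m≤1+n; m≤m⊔n; m≤n⊔m; ≤⇒≤′; 1+n≰n)
open import Data.Bool using (Bool; T; true; _∨_)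
open import Data.Bool.Properties using (T-∨; T-≡; T-irrelevant; ⇔→≡)
open import Data.Fin using (Fin; zero; suc; inject₁; fromℕ; _≟_; punchOut)
open import Data.Fin.Properties using (any?; punchOut-injective; injective⇒≤)
open import Data.Product using (Σ-syntax; ∃; _×_; _,_; _,′_; proj₁; proj₂)
open import Data.Sum using (_⊎_; inj₁; inj₂)
open import Data.Empty using (⊥-elim)
open import Data.Unit using (⊤; tt)
open import Data.List using (List; []; _∷_; _∷ʳ_; length; lookup)
open import Data.List.Relation.Unary.All using (All; []; _∷_)
import Data.List.Relation.Unary.All as All
open import Data.List.Relation.Unary.All.Properties using (∷ʳ⁺)
open import Data.List.Membership.Propositional.Properties using (∈-lookup)
open import Data.List.Relation.Unary.AllPairs using ([]; _∷_)
open import Data.List.Relation.Unary.Unique.Propositional using (Unique)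
open import Relation.Nullary using (¬_; Dec; yes; no; contradiction)
open import Relation.Nullary.Decidable using (_×-dec_; isYes; toWitness; fromWitness; map′)
open import Relation.Nullary.Decidable.Core using (T?)
open import Relation.Binary.PropositionalEquality using (_≡_; _≢_; refl; trans; cong; subst; subst₂)
import Relation.Binary.PropositionalEquality as ≡
open import Relation.Binary.Construct.Closure.ReflexiveTransitive using (Star; ε; _◅_)
open import Function using (_∘_; case_of_)
open import Function.Bundles using (Equivalence; Injection; _↔_; Inverse; mk↔ₛ′; mk⇔)
open import Function.Definitions using (Injective)
open import Function.Properties.Inverse using (↔⇒↣; ↔-sym)

↔-injective : ∀ {A B : Set} (f : A ↔ B) → Injective _≡_ _≡_ (Inverse.to f)
↔-injective f = Injection.injective (↔⇒↣ f)

T-⇔⇒≡ : ∀ {x y} → T x ⇔ T y → x ≡ y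
T-⇔⇒≡ h = ⇔→≡ {z = true} (mk⇔ (to T-≡ ∘ to h ∘ from T-≡) (to T-≡ ∘ from h ∘ from T-≡))
  where open Equivalence

injective⇒surjective : ∀ {n} (f : Fin n → Fin n) → Injective _≡_ _≡_ f → ∀ y → ∃ λ x → f x ≡ y
injective⇒surjective {suc n} f f-inj y with any? (λ x → f x ≟ y)
... | yes hit = hit
... | no miss = contradiction (injective⇒≤ {f = f-avoiding} f-avoiding-inj) 1+n≰n
  where
  y≢f : ∀ x → y ≢ f x
  y≢f x e = miss (x , ≡.sym e)
  f-avoiding : Fin (suc n) → Fin n
  f-avoiding x = punchOut (y≢f x)
  f-avoiding-inj : Injective _≡_ _≡_ f-avoiding
  f-avoiding-inj e = f-inj (punchOut-injective (y≢f _) (y≢f _) e)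

injective⇒↔ : ∀ {n} (f : Fin n → Fin n) → Injective _≡_ _≡_ f → Fin n ↔ Fin n
injective⇒↔ f f-inj = mk↔ₛ′ f (proj₁ ∘ onto) (proj₂ ∘ onto) (λ x → f-inj (proj₂ (onto (f x))))
  where onto = injective⇒surjective f f-inj

bounded : ∀ {n} (f : Fin n → ℕ) → ∃ λ K → ∀ i → f i ≤ K
bounded {zero} f = 0 , λ ()
bounded {suc n} f with bounded (f ∘ suc)
... | K , f∘suc≤K = f zero ⊔ K , λ where
  zero → m≤m⊔n (f zero) K
  (suc i) → ≤-trans (f∘suc≤K i) (m≤n⊔m (f zero) K)

Walk : ∀ {A : Set} → (A → A → Set) → A → List A → Set
Walk R x [] = ⊤
Walk R x (y ∷ ys) = R x y × Walk R y ys

end : ∀ {A : Set} → A → List A → A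
end x [] = x
end x (y ∷ ys) = end y ys

module _ {A : Set} where

  walk-∷ʳ : ∀ {R : A → A → Set} {x} ys {z} → Walk R x ys → R (end x ys) z → Walk R x (ys ∷ʳ z)
  walk-∷ʳ [] _ r = r , tt
  walk-∷ʳ (y ∷ ys) (r , w) r′ = r , walk-∷ʳ ys w r′

  end-∷ʳ : ∀ (x : A) ys z → end x (ys ∷ʳ z) ≡ z
  end-∷ʳ x [] z = refl
  end-∷ʳ x (y ∷ ys) z = end-∷ʳ y ys z

  All-end : ∀ {P : A → Set} {x} ys → All P (x ∷ ys) → P (end x ys)
  All-end [] (p ∷ []) = p
  All-end (y ∷ ys) (_ ∷ ps) = All-end ys ps

  lookup-end : ∀ (x : A) ys → lookup (x ∷ ys) (fromℕ (length ys)) ≡ end x ys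
  lookup-end x [] = refl
  lookup-end x (y ∷ ys) = lookup-end y ys

  walk-lookup : ∀ {R : A → A → Set} {x} ys → Walk R x ys →
                ∀ k → R (lookup (x ∷ ys) (inject₁ k)) (lookup (x ∷ ys) (suc k))
  walk-lookup (y ∷ ys) (r , _) zero = r
  walk-lookup (y ∷ ys) (_ , w) (suc k) = walk-lookup ys w k

  lookup-injective : ∀ {xs : List A} → Unique xs → Injective _≡_ _≡_ (lookup xs)
  lookup-injective {x ∷ xs} _ {zero} {zero} _ = refl
  lookup-injective {x ∷ xs} (x∉xs ∷ _) {zero} {suc j} e = ⊥-elim (All.lookup x∉xs (∈-lookup j) e)
  lookup-injective {x ∷ xs} (x∉xs ∷ _) {suc i} {zero} e =
    ⊥-elim (All.lookup x∉xs (∈-lookup i) (≡.sym e))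
  lookup-injective {x ∷ xs} (_ ∷ u) {suc i} {suc j} e = cong suc (lookup-injective u e)

  Unique-∷ʳ : ∀ {xs : List A} {z} → Unique xs → All (z ≢_) xs → Unique (xs ∷ʳ z)
  Unique-∷ʳ [] [] = [] ∷ []
  Unique-∷ʳ (x∉xs ∷ u) (z≢x ∷ z∉xs) = ∷ʳ⁺ x∉xs (z≢x ∘ ≡.sym) ∷ Unique-∷ʳ u z∉xs

module _ {n} (G : Graph n) where

  Adj-sym : ∀ {i j} → Adj G i j → Adj G j i
  Adj-sym {i} {j} = subst T (Graph.sym G i j)

  Adj-irrefl : ∀ {i} → ¬ Adj G i i
  Adj-irrefl {i} = subst T (Graph.irrefl G i)

  Nbr-≡ : ∀ {i} {u v : Nbr G i} → proj₁ u ≡ proj₁ v → u ≡ v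
  Nbr-≡ {u = x , p} {.x , q} refl = cong (x ,_) (T-irrelevant p q)

  closedWalk⇒cycle : ∀ x y z zs → Unique (x ∷ y ∷ z ∷ zs) → Walk (Adj G) x (y ∷ z ∷ zs) →
                     Adj G (end z zs) x → Cycle G
  closedWalk⇒cycle x y z zs distinct walk closing = record
    { m = length zs
    ; v = lookup (x ∷ y ∷ z ∷ zs)
    ; inj = lookup-injective distinct
    ; step = walk-lookup (y ∷ z ∷ zs) walk
    ; close = subst (λ e → Adj G e x) (≡.sym (lookup-end z zs)) closing
    }

Adj-flip⇔ : ∀ {m n} (G₁ : Graph m) (G₂ : Graph n) {i j x y} →
            Adj G₁ j i ⇔ Adj G₂ y x → Adj G₁ i j ⇔ Adj G₂ x y
Adj-flip⇔ G₁ G₂ h = mk⇔ (Adj-sym G₂ ∘ Equivalence.to h ∘ Adj-sym G₁)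
                        (Adj-sym G₁ ∘ Equivalence.from h ∘ Adj-sym G₂)

module Balls {n} (G : Graph n) (a : Fin n) where

  inBall : ℕ → Fin n → Bool
  inBall zero x = isYes (x ≟ a)
  inBall (suc k) x = inBall k x ∨ isYes (any? λ y → T? (adj G x y) ×-dec T? (inBall k y))

  record Ball (k : ℕ) (x : Fin n) : Set where
    constructor ball
    field member : T (inBall k x)

  Ball-irrelevant : ∀ {k x} (r s : Ball k x) → r ≡ s
  Ball-irrelevant (ball r) (ball s) = cong ball (T-irrelevant r s)

  Parent : ℕ → Fin n → Set
  Parent k x = Σ[ p ∈ Fin n ] Adj G x p × Ball k p

  ball? : ∀ k x → Dec (Ball k x)
  ball? k x = map′ ball Ball.member (T? (inBall k x))

  ball₀⇒≡center : ∀ {x} → Ball 0 x → x ≡ a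
  ball₀⇒≡center (ball r) = toWitness r

  ball-grow : ∀ {k x} → Ball k x → Ball (suc k) x
  ball-grow (ball r) = ball (Equivalence.from T-∨ (inj₁ r))

  ball-neighbour : ∀ {k x y} → Adj G x y → Ball k y → Ball (suc k) x
  ball-neighbour {k} {x} {y} x~y y∈ =
    ball (Equivalence.from (T-∨ {inBall k x}) (inj₂ (fromWitness (y , x~y , Ball.member y∈))))

  center∈ball : ∀ k → Ball k a
  center∈ball zero = ball (fromWitness refl)
  center∈ball (suc k) = ball-grow (center∈ball k)

  ball-suc⁻ : ∀ {k x} → Ball (suc k) x → Ball k x ⊎ Parent k x
  ball-suc⁻ {k} {x} (ball r) with Equivalence.to (T-∨ {inBall k x}) r
  ... | inj₁ x∈ = inj₁ (ball x∈)
  ... | inj₂ par with p , x~p , p∈ ← toWitness par = inj₂ (p , x~p , ball p∈)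

  ball-parent : ∀ {k x} → Ball (suc k) x → ¬ Ball k x → Parent k x
  ball-parent x∈ x∉ with ball-suc⁻ x∈
  ... | inj₁ x∈′ = contradiction x∈′ x∉
  ... | inj₂ par = par

  ball-mono : ∀ {k l x} → k ≤ l → Ball k x → Ball l x
  ball-mono = go ∘ ≤⇒≤′
    where
    go : ∀ {k l x} → k ≤′ l → Ball k x → Ball l x
    go ≤′-refl r = r
    go (≤′-step h) r = ball-grow (go h r)

  walk⇒ball : ∀ {k x y} → Star (Adj G) x y → Ball k x → ∃ λ l → Ball l y
  walk⇒ball ε r = _ , r
  walk⇒ball (x~z ◅ walk) r = walk⇒ball walk (ball-neighbour (Adj-sym G x~z) r)

  connected⇒covered : Connected G → ∃ λ K → ∀ x → Ball K x
  connected⇒covered connected = K , λ x → ball-mono (radius-bound x) (proj₂ (reach x))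
    where
    reach : ∀ x → ∃ λ l → Ball l x
    reach x = walk⇒ball (connected a x) (center∈ball 0)
    K = proj₁ (bounded (proj₁ ∘ reach))
    radius-bound = proj₂ (bounded (proj₁ ∘ reach))

  inside≢outside : ∀ {j p q} → Ball j p → ¬ Ball j q → p ≢ q
  inside≢outside p∈ q∉ refl = q∉ p∈

  -- Replace both endpoints by their parents in the ball of radius j: either the parents
  -- coincide and the walk closes up, or the longer walk satisfies the hypotheses for j - 1.
  outerWalk⇒cycle : ∀ j {u w} ys → Walk (Adj G) u ys → end u ys ≡ w → u ≢ w →
                    All (λ y → ¬ Ball j y) (u ∷ ys) → Unique (u ∷ ys) →
                    Ball (suc j) u → Ball (suc j) w → Cycle G
  outerWalk⇒cycle j [] _ refl u≢w _ _ _ _ = ⊥-elim (u≢w refl)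
  outerWalk⇒cycle j {u} ys@(z ∷ zs) walk refl u≢w outside distinct u∈ w∈
    with ball-parent u∈ (All.head outside) | ball-parent w∈ (All-end ys outside)
  ... | pu , u~pu , pu∈ | pw , w~pw , pw∈ with pu ≟ pw
  ...   | yes refl = closedWalk⇒cycle G pu u z zs (All.map (inside≢outside pu∈) outside ∷ distinct)
                       (Adj-sym G u~pu , walk) w~pw
  outerWalk⇒cycle zero ys@(z ∷ zs) walk refl u≢w outside distinct u∈ w∈
    | pu , u~pu , pu∈ | pw , w~pw , pw∈ | no pu≢pw =
      ⊥-elim (pu≢pw (trans (ball₀⇒≡center pu∈) (≡.sym (ball₀⇒≡center pw∈))))
  outerWalk⇒cycle (suc j) {u} ys@(z ∷ zs) walk refl u≢w outside distinct u∈ w∈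
    | pu , u~pu , pu∈ | pw , w~pw , pw∈ | no pu≢pw =
      outerWalk⇒cycle j (u ∷ ys ∷ʳ pw) (Adj-sym G u~pu , walk-∷ʳ ys walk w~pw)
        (end-∷ʳ u ys pw) pu≢pw
        (pu∉ ∷ ∷ʳ⁺ (All.map (_∘ ball-grow) outside) pw∉)
        (∷ʳ⁺ (All.map (inside≢outside pu∈) outside) pu≢pw
          ∷ Unique-∷ʳ distinct (All.map (inside≢outside pw∈) outside))
        pu∈ pw∈
    where
    pu∉ : ¬ Ball j pu
    pu∉ = All.head outside ∘ ball-neighbour u~pu
    pw∉ : ¬ Ball j pw
    pw∉ = All-end ys outside ∘ ball-neighbour w~pw

  acyclic⇒unique-parent : Acyclic G → ∀ {k x} → ¬ Ball k x → (p q : Parent k x) → proj₁ p ≡ proj₁ q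
  acyclic⇒unique-parent _ {zero} _ (y , _ , y∈) (z , _ , z∈) =
    trans (ball₀⇒≡center y∈) (≡.sym (ball₀⇒≡center z∈))
  acyclic⇒unique-parent acyclic {suc k} {x} x∉ (y , x~y , y∈) (z , x~z , z∈) with y ≟ z
  ... | yes y≡z = y≡z
  ... | no y≢z = ⊥-elim (acyclic (outerWalk⇒cycle k (x ∷ z ∷ []) (Adj-sym G x~y , x~z , tt) refl y≢z
                   (y∉ ∷ x∉ ∘ ball-grow ∷ z∉ ∷ [])
                   ((inside≢outside y∈ x∉ ∷ y≢z ∷ [])
                     ∷ (inside≢outside z∈ x∉ ∘ ≡.sym ∷ []) ∷ [] ∷ [])
                   y∈ z∈))
    where
    y∉ : ¬ Ball k y
    y∉ = x∉ ∘ ball-neighbour x~y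
    z∉ : ¬ Ball k z
    z∉ = x∉ ∘ ball-neighbour x~z

  acyclic⇒sphere-independent : Acyclic G → ∀ {k x y} → ¬ Ball k x → ¬ Ball k y →
                               Ball (suc k) x → Ball (suc k) y → ¬ Adj G x y
  acyclic⇒sphere-independent acyclic {k} {x} {y} x∉ y∉ x∈ y∈ x~y =
    acyclic (outerWalk⇒cycle k (y ∷ []) (x~y , tt) refl x≢y
               (x∉ ∷ y∉ ∷ []) ((x≢y ∷ []) ∷ [] ∷ []) x∈ y∈)
    where
    x≢y : x ≢ y
    x≢y refl = Adj-irrefl G x~y

col-≡1⇔ : ∀ {n} {a i : Fin n} → col a i ≡ 1 ⇔ i ≡ a
col-≡1⇔ {a = a} {i} with i ≟ a
... | yes i≡a = mk⇔ (λ _ → i≡a) (λ _ → refl)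
... | no i≢a = mk⇔ (λ ()) (⊥-elim ∘ i≢a)

col-cong : ∀ {m n} {a i : Fin m} {b j : Fin n} → (i ≡ a ⇔ j ≡ b) → col a i ≡ col b j
col-cong {a = a} {i} {b} {j} h with i ≟ a | j ≟ b
... | yes _ | yes _ = refl
... | no _ | no _ = refl
... | yes i≡a | no j≢b = ⊥-elim (j≢b (Equivalence.to h i≡a))
... | no i≢a | yes j≡b = ⊥-elim (i≢a (Equivalence.from h j≡b))

module _ {m n} {G₁ : Graph m} {a : Fin m} {G₂ : Graph n} {b : Fin n} where
  private
    module B₁ = Balls G₁ a
    module B₂ = Balls G₂ b

  LabelEq⇒col : ∀ {l i j} → LabelEq G₁ a G₂ b l i j → col a i ≡ col b j
  LabelEq⇒col {zero} e = e
  LabelEq⇒col {suc l} (e , _) = LabelEq⇒col e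

  LabelEq-sym : ∀ {l i j} → LabelEq G₁ a G₂ b l i j → LabelEq G₂ b G₁ a l j i
  LabelEq-sym {zero} e = ≡.sym e
  LabelEq-sym {suc l} (e , f , f-lab) = LabelEq-sym e , ↔-sym f , λ y →
    LabelEq-sym (subst (LabelEq G₁ a G₂ b l (proj₁ (Inverse.from f y)) ∘ proj₁)
                       (Inverse.strictlyInverseˡ f y) (f-lab (Inverse.from f y)))

  LabelEq⇒ball : ∀ {k l i j} → k ≤ l → LabelEq G₁ a G₂ b l i j → B₁.Ball k i → B₂.Ball k j
  LabelEq⇒ball {zero} _ e i∈ = subst (B₂.Ball 0) (≡.sym j≡b) (B₂.center∈ball 0)
    where
    j≡b = Equivalence.to col-≡1⇔
            (trans (≡.sym (LabelEq⇒col e)) (Equivalence.from col-≡1⇔ (B₁.ball₀⇒≡center i∈)))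
  LabelEq⇒ball {suc k} (s≤s k≤l) (e , f , f-lab) i∈ with B₁.ball-suc⁻ i∈
  ... | inj₁ i∈′ = B₂.ball-grow (LabelEq⇒ball k≤l e i∈′)
  ... | inj₂ (y , i~y , y∈) =
        B₂.ball-neighbour (proj₂ (Inverse.to f (y , i~y))) (LabelEq⇒ball k≤l (f-lab (y , i~y)) y∈)

LabelEq⇒ball⇔ : ∀ {m n} {G₁ : Graph m} {a : Fin m} {G₂ : Graph n} {b : Fin n} {k l i j} → k ≤ l →
                LabelEq G₁ a G₂ b l i j → Balls.Ball G₁ a k i ⇔ Balls.Ball G₂ b k j
LabelEq⇒ball⇔ k≤l e = mk⇔ (LabelEq⇒ball k≤l e) (LabelEq⇒ball k≤l (LabelEq-sym e))

module _ {n} {G₁ G₂ : Graph n} (φ : Fin n ↔ Fin n)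
         (φ-adj : ∀ i j → adj G₁ i j ≡ adj G₂ (Inverse.to φ i) (Inverse.to φ j)) where
  open Inverse φ using (to; from; strictlyInverseˡ; strictlyInverseʳ)

  iso⇒Nbr↔ : ∀ i → Nbr G₁ i ↔ Nbr G₂ (to i)
  iso⇒Nbr↔ i = mk↔ₛ′ forth back (λ y → Nbr-≡ G₂ (strictlyInverseˡ (proj₁ y)))
                                (λ x → Nbr-≡ G₁ (strictlyInverseʳ (proj₁ x)))
    where
    forth : Nbr G₁ i → Nbr G₂ (to i)
    forth (j , i~j) = to j , subst T (φ-adj i j) i~j
    back : Nbr G₂ (to i) → Nbr G₁ i
    back (j , i~j) = from j , subst T (≡.sym (φ-adj i (from j)))
                                (subst (Adj G₂ (to i)) (≡.sym (strictlyInverseˡ j)) i~j)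

  iso⇒LabelEq : ∀ c l i → LabelEq G₁ c G₂ (to c) l i (to i)
  iso⇒LabelEq c zero i = col-cong (mk⇔ (cong to) (↔-injective φ))
  iso⇒LabelEq c (suc l) i = iso⇒LabelEq c l i , iso⇒Nbr↔ i , λ x → iso⇒LabelEq c l (proj₁ x)

isomorphic⇒S1Equivalent : ∀ {n} {G₁ G₂ : Graph n} → Isomorphic G₁ G₂ → S1Equivalent G₁ G₂
isomorphic⇒S1Equivalent (φ , φ-adj) = φ , λ c → φ , λ i l → iso⇒LabelEq φ φ-adj c l i

module Growth {n} {G₁ G₂ : Graph n} (acyclic₁ : Acyclic G₁) (acyclic₂ : Acyclic G₂) {a b c : Fin n}
              (a≈c : ∀ l → LabelEq G₁ a G₂ b l a c) where
  private
    module B₁ = Balls G₁ a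
    module B₂ = Balls G₂ b
    L = LabelEq G₁ a G₂ b

  -- Each extension lowers the label depth d by one: the neighbour bijection in a label
  -- of depth d + 1 only matches the labels of depth d of the neighbours.
  record BallIso (k d : ℕ) : Set where
    field
      φ : Fin n → Fin n
      label : ∀ {i} → B₁.Ball k i → L d i (φ i)
      injective : ∀ {i j} → B₁.Ball k i → B₁.Ball k j → φ i ≡ φ j → i ≡ j
      adjacency : ∀ {i j} → B₁.Ball k i → B₁.Ball k j → Adj G₁ i j ⇔ Adj G₂ (φ i) (φ j)

  center : ∀ d → BallIso 0 d
  center d = record
    { φ = λ _ → c
    ; label = λ i∈ → subst (λ i → L d i c) (≡.sym (B₁.ball₀⇒≡center i∈)) (a≈c d)
    ; injective = λ i∈ j∈ _ → trans (B₁.ball₀⇒≡center i∈) (≡.sym (B₁.ball₀⇒≡center j∈))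
    ; adjacency = λ i∈ j∈ → mk⇔
        (λ i~j → ⊥-elim (Adj-irrefl G₁
                   (subst₂ (Adj G₁) (B₁.ball₀⇒≡center i∈) (B₁.ball₀⇒≡center j∈) i~j)))
        (⊥-elim ∘ Adj-irrefl G₂)
    }

  module Extend {k d} (k<d : suc k ≤ d) (S : BallIso k (suc d)) where
    open BallIso S
      renaming (φ to ψ; label to ψ-label; injective to ψ-injective; adjacency to ψ-adjacency)

    child : ∀ {i} (par : B₁.Parent k i) → Nbr G₂ (ψ (proj₁ par))
    child {i} (p , i~p , p∈) = Inverse.to (proj₁ (proj₂ (ψ-label p∈))) (i , Adj-sym G₁ i~p)

    child-label : ∀ {i} (par : B₁.Parent k i) → L d i (proj₁ (child par))
    child-label {i} (p , i~p , p∈) = proj₂ (proj₂ (ψ-label p∈)) (i , Adj-sym G₁ i~p)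

    child-cong : ∀ {i} (par par′ : B₁.Parent k i) → proj₁ par ≡ proj₁ par′ →
                 proj₁ (child par) ≡ proj₁ (child par′)
    child-cong (p , i~p , p∈) (.p , i~p′ , p∈′) refl
      rewrite T-irrelevant i~p i~p′ | B₁.Ball-irrelevant p∈ p∈′ = refl

    child-injective : ∀ {i j} (pi : B₁.Parent k i) (pj : B₁.Parent k j) → proj₁ pi ≡ proj₁ pj →
                      proj₁ (child pi) ≡ proj₁ (child pj) → i ≡ j
    child-injective (p , i~p , p∈) (.p , j~p , p∈′) refl e rewrite B₁.Ball-irrelevant p∈ p∈′ =
      cong proj₁ (↔-injective (proj₁ (proj₂ (ψ-label p∈′))) (Nbr-≡ G₂ e))

    parent? : ∀ i → Dec (B₁.Parent k i)
    parent? i = any? λ p → T? (adj G₁ i p) ×-dec B₁.ball? k p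

    extendAt : ∀ i → Dec (B₁.Ball k i) → Dec (B₁.Parent k i) → Fin n
    extendAt i (yes _) _ = ψ i
    extendAt i (no _) (yes par) = proj₁ (child par)
    extendAt i (no _) (no _) = ψ i   -- only for nodes outside the ball of radius k + 1

    φ : Fin n → Fin n
    φ i = extendAt i (B₁.ball? k i) (parent? i)

    φ-old : ∀ {i} → B₁.Ball k i → φ i ≡ ψ i
    φ-old {i} i∈ with B₁.ball? k i
    ... | yes _ = refl
    ... | no i∉ = contradiction i∈ i∉

    φ-new : ∀ {i} → ¬ B₁.Ball k i → (par : B₁.Parent k i) → φ i ≡ proj₁ (child par)
    φ-new {i} i∉ par with B₁.ball? k i | parent? i
    ... | yes i∈ | _ = contradiction i∈ i∉
    ... | no _ | yes par′ =
          child-cong par′ par (Balls.acyclic⇒unique-parent G₁ a acyclic₁ i∉ par′ par)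
    ... | no _ | no ¬par = contradiction par ¬par

    module New {i} (i∉ : ¬ B₁.Ball k i) (i∈ : B₁.Ball (suc k) i) where
      par : B₁.Parent k i
      par = B₁.ball-parent i∈ i∉

      p : Fin n
      p = proj₁ par

      i~p : Adj G₁ i p
      i~p = proj₁ (proj₂ par)

      p∈ : B₁.Ball k p
      p∈ = proj₂ (proj₂ par)

      label : L d i (φ i)
      label = subst (L d i) (≡.sym (φ-new i∉ par)) (child-label par)

      adj-parent : Adj G₂ (φ i) (ψ p)
      adj-parent =
        subst (λ x → Adj G₂ x (ψ p)) (≡.sym (φ-new i∉ par)) (Adj-sym G₂ (proj₂ (child par)))

      inside : B₂.Ball (suc k) (φ i)
      inside = Equivalence.to (LabelEq⇒ball⇔ k<d label) i∈

      outside : ¬ B₂.Ball k (φ i)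
      outside = i∉ ∘ Equivalence.from (LabelEq⇒ball⇔ (≤-trans (n≤1+n k) k<d) label)

    ψ-inside : ∀ {i} → B₁.Ball k i → B₂.Ball k (ψ i)
    ψ-inside i∈ = Equivalence.to (LabelEq⇒ball⇔ (m<n⇒m≤1+n k<d) (ψ-label i∈)) i∈

    φ-inside : ∀ {i} → B₁.Ball k i → B₂.Ball k (φ i)
    φ-inside i∈ = subst (B₂.Ball k) (≡.sym (φ-old i∈)) (ψ-inside i∈)

    label : ∀ {i} → B₁.Ball (suc k) i → L d i (φ i)
    label {i} i∈ = case B₁.ball? k i of λ where
      (yes i∈′) → subst (L d i) (≡.sym (φ-old i∈′)) (proj₁ (ψ-label i∈′))
      (no i∉) → New.label i∉ i∈

    new-injective : ∀ {i j} (i∉ : ¬ B₁.Ball k i) (i∈ : B₁.Ball (suc k) i)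
                    (j∉ : ¬ B₁.Ball k j) (j∈ : B₁.Ball (suc k) j) → φ i ≡ φ j → i ≡ j
    new-injective i∉ i∈ j∉ j∈ e =
      child-injective I.par J.par (ψ-injective I.p∈ J.p∈ ψpi≡ψpj)
        (trans (≡.sym (φ-new i∉ I.par)) (trans e (φ-new j∉ J.par)))
      where
      module I = New i∉ i∈
      module J = New j∉ j∈
      ψpi≡ψpj = Balls.acyclic⇒unique-parent G₂ b acyclic₂ I.outside
                  (_ , I.adj-parent , ψ-inside I.p∈)
                  (_ , subst (λ x → Adj G₂ x _) (≡.sym e) J.adj-parent , ψ-inside J.p∈)

    injective : ∀ {i j} → B₁.Ball (suc k) i → B₁.Ball (suc k) j → φ i ≡ φ j → i ≡ j
    injective {i} {j} i∈ j∈ e = case (B₁.ball? k i ,′ B₁.ball? k j) of λ where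
      (yes i∈′ , yes j∈′) → ψ-injective i∈′ j∈′ (trans (≡.sym (φ-old i∈′)) (trans e (φ-old j∈′)))
      (yes i∈′ , no j∉) → contradiction (subst (B₂.Ball k) e (φ-inside i∈′)) (New.outside j∉ j∈)
      (no i∉ , yes j∈′) →
        contradiction (subst (B₂.Ball k) (≡.sym e) (φ-inside j∈′)) (New.outside i∉ i∈)
      (no i∉ , no j∉) → new-injective i∉ i∈ j∉ j∈ e

    new-old-adjacency : ∀ {i j} → ¬ B₁.Ball k i → B₁.Ball (suc k) i → B₁.Ball k j →
                        Adj G₁ i j ⇔ Adj G₂ (φ i) (φ j)
    new-old-adjacency {i} {j} i∉ i∈ j∈ = mk⇔ forth back
      where
      open New i∉ i∈
      forth : Adj G₁ i j → Adj G₂ (φ i) (φ j)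
      forth i~j = subst (Adj G₂ (φ i)) (≡.sym (trans (φ-old j∈) (cong ψ j≡p))) adj-parent
        where
        j≡p = Balls.acyclic⇒unique-parent G₁ a acyclic₁ i∉ (j , i~j , j∈) par
      back : Adj G₂ (φ i) (φ j) → Adj G₁ i j
      back φi~φj = subst (Adj G₁ i) (≡.sym j≡p) i~p
        where
        ψj≡ψp = Balls.acyclic⇒unique-parent G₂ b acyclic₂ outside
                  (ψ j , subst (Adj G₂ (φ i)) (φ-old j∈) φi~φj , ψ-inside j∈)
                  (ψ p , adj-parent , ψ-inside p∈)
        j≡p = ψ-injective j∈ p∈ ψj≡ψp

    adjacency : ∀ {i j} → B₁.Ball (suc k) i → B₁.Ball (suc k) j → Adj G₁ i j ⇔ Adj G₂ (φ i) (φ j)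
    adjacency {i} {j} i∈ j∈ = case (B₁.ball? k i ,′ B₁.ball? k j) of λ where
      (yes i∈′ , yes j∈′) → subst₂ (λ x y → Adj G₁ i j ⇔ Adj G₂ x y)
                              (≡.sym (φ-old i∈′)) (≡.sym (φ-old j∈′)) (ψ-adjacency i∈′ j∈′)
      (no i∉ , yes j∈′) → new-old-adjacency i∉ i∈ j∈′
      (yes i∈′ , no j∉) → Adj-flip⇔ G₁ G₂ (new-old-adjacency j∉ j∈ i∈′)
      (no i∉ , no j∉) → mk⇔
        (⊥-elim ∘ Balls.acyclic⇒sphere-independent G₁ a acyclic₁ i∉ j∉ i∈ j∈)
        (⊥-elim ∘ Balls.acyclic⇒sphere-independent G₂ b acyclic₂
                    (New.outside i∉ i∈) (New.outside j∉ j∈) (New.inside i∉ i∈) (New.inside j∉ j∈))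

    result : BallIso (suc k) d
    result = record { φ = φ ; label = label ; injective = injective ; adjacency = adjacency }

  grow : ∀ k d → k ≤ d → BallIso k d
  grow zero d _ = center d
  grow (suc k) d k<d = Extend.result k<d (grow k (suc d) (m<n⇒m≤1+n k<d))

S1Equivalent⇒isomorphic : ∀ {n} {G₁ G₂ : Graph n} → Connected G₁ → Acyclic G₁ → Acyclic G₂ →
                          Fin n → S1Equivalent G₁ G₂ → Isomorphic G₁ G₂
S1Equivalent⇒isomorphic {G₁ = G₁} connected acyclic₁ acyclic₂ a (_ , rows)
  with K , covered ← Balls.connected⇒covered G₁ a connected
     | _ , same-row ← rows a =
  injective⇒↔ φ (injective (covered _) (covered _)) ,
  λ i j → T-⇔⇒≡ (adjacency (covered i) (covered j))
  where
  open Growth acyclic₁ acyclic₂ (same-row a) using (BallIso; grow)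
  open BallIso (grow K K ≤-refl)

theorem9 : (n : ℕ) → 2 ≤ n → (G₁ G₂ : Graph n) → IsTree G₁ → IsTree G₂ →
           (Isomorphic G₁ G₂ ⇔ S1Equivalent G₁ G₂)
theorem9 (suc n) _ G₁ G₂ (connected₁ , acyclic₁) (_ , acyclic₂) =
  mk⇔ isomorphic⇒S1Equivalent (S1Equivalent⇒isomorphic connected₁ acyclic₁ acyclic₂ zero)
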